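{- Fix an integer $k \geq 2$ and integers $m_2, m_3, \ldots, m_k$ with $0 \leq m_i < i$ for all $i$. Then there exists $n \geq 0$ with $\bar{b}_i(n) = m_i$ for all $2 \leq i \leq k$ if and only if, for every $i \in \{2, \ldots, k\}$ and every divisor $d$ of $i$ with $1 < d < i$ that is a power of a prime, \[ m_i + m_{i-1} + \cdots + m_{i-d+1} \equiv 0 \pmod{d}. \] Moreover, if $\bar{b}_i(n) = m_i$ for all $2 \leq i \leq k$, then also $\bar{b}_i(n + r \cdot \mathrm{lcm}(2, \ldots, k)) = m_i$ for all $2 \leq i \leq k$ and all integers $r$ with $n + r\cdot \mathrm{lcm}(2, \ldots, k) \geq 0$.
   Context: Tchoukaillon boards. For each $n \geq 0$ define a sequence $b(n) = (b_1(n), b_2(n), \ldots)$ of nonnegative integers recursively: $b(0)$ is the all-zero sequence; given $b(n)$, let $p(n) = \min\{j \geq 1 : b_j(n) = 0\}$ and set $b_i(n+1) = b_i(n)$ if $i > p(n)$, $b_i(n+1) = i$ if $i = p(n)$, and $b_i(n+1) = b_i(n) - 1$ if $i < p(n)$. Reindexed boards: $\bar{b}_i(n) = b_{i-1}(n)$ for $i \geq 2$ (so $0 \le \bar b_i(n) < i$). -}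

module Defs where

open import Data.Nat using (ℕ; zero; suc; _+_; _∸_)
open import Data.Nat.LCM using (lcm)
open import Data.List using (List; []; _∷_)
open import Data.Maybe using (Maybe; just; nothing; fromMaybe)

-- A board is a finite list [b_1, b_2, ..., b_L]; all entries beyond the
-- list are 0.  (b(n) has b_j(n) = 0 for j > n, so this loses nothing.)
Board : Set
Board = List ℕ

-- b_j of a board, 1-indexed (index 0 is unused and returns 0).
entry : Board → ℕ → ℕ
entry []       _             = 0
entry (x ∷ xs) zero          = 0
entry (x ∷ xs) (suc zero)    = x
entry (x ∷ xs) (suc (suc j)) = entry xs (suc j)

-- Scanning position i (starting at i = 1):
--   if b_i ≠ 0, it is some i < p, so decrement it and continue;
--   if b_i = 0 (or the list ended, so b_i = 0), this is p: set b_p := p,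
--   entries beyond p are unchanged.
stepFrom : ℕ → Board → Board
stepFrom i []             = i ∷ []
stepFrom i (zero ∷ xs)    = i ∷ xs
stepFrom i (suc x ∷ xs)   = x ∷ stepFrom (suc i) xs

step : Board → Board
step = stepFrom 1

board : ℕ → Board
board zero    = []
board (suc n) = step (board n)

b : ℕ → ℕ → ℕ
b n i = entry (board n) i

bbar : ℕ → ℕ → ℕ
bbar n i = b n (i ∸ 1)

-- lcm(2, ..., k)  (lcmUpTo k = lcm(1, ..., k); lcm(1) = 1, lcmUpTo 0 = 1)
lcmUpTo : ℕ → ℕ
lcmUpTo zero    = 1
lcmUpTo (suc k) = lcm (suc k) (lcmUpTo k)

windowSum : (ℕ → ℕ) → ℕ → ℕ → ℕ
windowSum m i zero    = 0
windowSum m i (suc d) = m (i ∸ d) + windowSum m i d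

module Submission where

-- 1. The board after n moves is a mixed-radix expansion of n: one sowing
--    step adds 1 to the encoded number (stepEncodes), which yields the
--    closed form b̄_{j+2}(n) = rest n j mod (j+2), where rest n j is n minus
--    the first j board entries (bbar≡rest%).
-- 2. Tracking rest shows that b̄_i(n) = m_i for 2 ≤ i ≤ k is the system of
--    congruences n ≡ m₂ + ⋯ + m_i (mod i), 2 ≤ i ≤ k (matches⇒congruent, congruent⇒matches).
-- 3. Necessity and periodicity are then immediate: the congruences at i
--    and i - d, compared modulo a proper divisor d of i, give d ∣ window;
--    and the system only depends on n modulo lcm(2, …, k).
-- 4. Sufficiency solves the system one modulus K+1 at a time (Sufficiency):
--    a Chinese-remainder step reduces to a congruence modulo
--    gcd(lcm(1, …, K), K+1), which may be checked on its prime-power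
--    divisors q; these are proper divisors of K+1, where the window
--    conditions apply.

open import Defs
open import Data.Nat
open import Data.Nat.Properties
open import Data.Nat.DivMod
open import Data.Nat.Divisibility
open import Data.Nat.LCM using (lcm; m∣lcm[m,n]; n∣lcm[m,n]; lcm-least)
open import Data.Nat.GCD using (gcd; gcd-GCD; module Bézout; gcd[m,n]≢0; gcd[m,n]∣m; gcd[m,n]∣n)
open import Data.Nat.Coprimality using (Coprime; coprime-divisor)
open import Data.Nat.Primality using (Prime; prime⇒nonTrivial; prime⇒nonZero; prime⇒irreducible; euclidsLemma)
open import Data.Nat.Primality.Factorisation using (factorise)
open import Data.Nat.ListAction using (product)
open import Data.Nat.Induction using (<-rec)
open import Data.Nat.Tactic.RingSolver using (solve-∀)
open import Data.Integer as ℤ using (ℤ; +_; -[1+_])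
import Data.Integer.Properties as ℤP
import Data.Integer.Tactic.RingSolver as ℤ-Solver
open import Data.List using ([]; _∷_)
open import Data.List.Relation.Unary.All using (_∷_)
open import Data.Product using (∃₂; ∃-syntax; _,_; _×_; proj₁; proj₂)
open import Data.Sum using (inj₁; inj₂)
open import Function.Bundles using (_⇔_; mk⇔)
open import Relation.Nullary using (¬_; yes; no; contradiction)
open import Relation.Binary.PropositionalEquality

-- Congruences on ℕ

infix 4 _≡[_]_

-- x ≡ y (mod d), stated without subtraction: x + a·d = y + b·d.
_≡[_]_ : ℕ → ℕ → ℕ → Set
x ≡[ d ] y = ∃₂ λ a b → x + a * d ≡ y + b * d

≡mod-refl : ∀ {d} x → x ≡[ d ] x
≡mod-refl x = 0 , 0 , refl

≡mod-sym : ∀ {d x y} → x ≡[ d ] y → y ≡[ d ] x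
≡mod-sym (a , b , e) = b , a , sym e

≡mod-trans : ∀ {d x y z} → x ≡[ d ] y → y ≡[ d ] z → x ≡[ d ] z
≡mod-trans {d} {x} {y} {z} (a , b , x≡y) (c , e , y≡z) = a + c , e + b , (begin
  x + (a + c) * d      ≡⟨ shuffle x a c d ⟩
  (x + a * d) + c * d  ≡⟨ cong (_+ c * d) x≡y ⟩
  (y + b * d) + c * d  ≡⟨ swap y b c d ⟩
  (y + c * d) + b * d  ≡⟨ cong (_+ b * d) y≡z ⟩
  (z + e * d) + b * d  ≡⟨ shuffle z e b d ⟨
  z + (e + b) * d      ∎)
  where
  open ≡-Reasoning
  shuffle : ∀ x a c d → x + (a + c) * d ≡ (x + a * d) + c * d
  shuffle = solve-∀
  swap : ∀ y b c d → (y + b * d) + c * d ≡ (y + c * d) + b * d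
  swap = solve-∀

≡mod-+ : ∀ {d x y u v} → x ≡[ d ] y → u ≡[ d ] v → x + u ≡[ d ] y + v
≡mod-+ {d} {x} {y} {u} {v} (a , b , x≡y) (c , e , u≡v) = a + c , b + e , (begin
  x + u + (a + c) * d        ≡⟨ shuffle x u a c d ⟩
  (x + a * d) + (u + c * d)  ≡⟨ cong₂ _+_ x≡y u≡v ⟩
  (y + b * d) + (v + e * d)  ≡⟨ shuffle y v b e d ⟨
  y + v + (b + e) * d        ∎)
  where
  open ≡-Reasoning
  shuffle : ∀ x u a c d → x + u + (a + c) * d ≡ (x + a * d) + (u + c * d)
  shuffle = solve-∀

≡mod-cancelʳ : ∀ {d x y} z → x + z ≡[ d ] y + z → x ≡[ d ] y
≡mod-cancelʳ {d} {x} {y} z (a , b , e) =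
  a , b , +-cancelʳ-≡ z _ _ (trans (shuffle x z a d) (trans e (sym (shuffle y z b d))))
  where
  shuffle : ∀ x z a d → x + a * d + z ≡ x + z + a * d
  shuffle = solve-∀

≡mod-*ˡ : ∀ {d x y} c → x ≡[ d ] y → c * x ≡[ d ] c * y
≡mod-*ˡ {d} {x} {y} c (a , b , e) =
  c * a , c * b , trans (distrib c x a d) (trans (cong (c *_) e) (sym (distrib c y b d)))
  where
  distrib : ∀ c x a d → c * x + c * a * d ≡ c * (x + a * d)
  distrib = solve-∀

≡mod-∣ : ∀ {e d x y} → e ∣ d → x ≡[ d ] y → x ≡[ e ] y
≡mod-∣ {e} {d} {x} {y} (divides q refl) (a , b , eq) = a * q , b * q ,
  trans (cong (_+_ x) (*-assoc a q e)) (trans eq (cong (_+_ y) (sym (*-assoc b q e))))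

+-multiple : ∀ {d t} x → d ∣ t → x + t ≡[ d ] x
+-multiple x (divides q refl) = 0 , q , +-identityʳ _

≡0⇒∣ : ∀ {d x} → x ≡[ d ] 0 → d ∣ x
≡0⇒∣ {d} {x} (a , b , e) =
  ∣m+n∣m⇒∣n (subst (d ∣_) (trans (sym e) (+-comm x (a * d))) (n∣m*n b)) (n∣m*n a)

≡mod⇒% : ∀ {d x y} .{{_ : NonZero d}} → x ≡[ d ] y → y < d → x % d ≡ y
≡mod⇒% {d} {x} {y} (a , b , e) y<d = begin
  x % d            ≡⟨ [m+kn]%n≡m%n x a d ⟨
  (x + a * d) % d  ≡⟨ cong (_% d) e ⟩
  (y + b * d) % d  ≡⟨ [m+kn]%n≡m%n y b d ⟩
  y % d            ≡⟨ m<n⇒m%n≡m y<d ⟩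
  y                ∎
  where open ≡-Reasoning

-- Boards as digit expansions

-- digit i N j is the entry at position i + j of the board that encodes N
-- from position i on: position i holds N mod (i+1), and the positions
-- after it encode the multiple N - (N mod (i+1)) from position i+1 on.
digit : ℕ → ℕ → ℕ → ℕ
digit i N zero    = N % suc i
digit i N (suc j) = digit (suc i) (N ∸ N % suc i) j

-- The board xs, whose head sits at position i, encodes N.
Encodes : ℕ → ℕ → Board → Set
Encodes i N xs = ∀ j → entry xs (suc j) ≡ digit i N j

digitSplit : ∀ {M} i Q r → M ≡ Q + r → suc i ∣ Q → r < suc i →
             M % suc i ≡ r × M ∸ M % suc i ≡ Q
digitSplit i Q r refl i+1∣Q r<i+1 = M%≡r , trans (cong (λ r′ → Q + r ∸ r′) M%≡r) (m+n∸n≡m Q r)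
  where
  M%≡r : (Q + r) % suc i ≡ r
  M%≡r = trans (%-remove-+ˡ r i+1∣Q) (m<n⇒m%n≡m r<i+1)

∣m∸m%n : ∀ M n .{{_ : NonZero n}} → n ∣ M ∸ M % n
∣m∸m%n M n = divides (M / n) (begin
  M ∸ M % n                  ≡⟨ cong (_∸ M % n) (m≡m%n+[m/n]*n M n) ⟩
  M % n + M / n * n ∸ M % n  ≡⟨ m+n∸m≡n (M % n) _ ⟩
  M / n * n                  ∎)
  where open ≡-Reasoning

sowEmpty : ∀ i N tail → N % suc i ≡ 0 → Encodes (suc i) (N ∸ N % suc i) tail →
           Encodes i (N + i) (i ∷ tail)
sowEmpty i N tail N%≡0 enc = λ where
    zero    → sym (proj₁ split)
    (suc j) → trans (enc j) (cong (λ M → digit (suc i) M j) rest≡)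
  where
  split : (N + i) % suc i ≡ i × N + i ∸ (N + i) % suc i ≡ N
  split = digitSplit i N i refl (m%n≡0⇒n∣m N (suc i) N%≡0) (n<1+n i)
  rest≡ : N ∸ N % suc i ≡ N + i ∸ (N + i) % suc i
  rest≡ = trans (cong (N ∸_) N%≡0) (sym (proj₂ split))

stepEncodes : ∀ xs i N → Encodes i N xs → Encodes i (N + i) (stepFrom i xs)
stepEncodes []          i N enc = sowEmpty i N [] (sym (enc 0)) (λ j → enc (suc j))
stepEncodes (zero ∷ xs) i N enc = sowEmpty i N xs (sym (enc 0)) (λ j → enc (suc j))
stepEncodes (suc x ∷ xs) i N enc = λ where
    zero    → sym (proj₁ split)
    (suc j) → trans (ih j) (cong (λ M → digit (suc i) M j) (sym (proj₂ split)))
  where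
  N%≡ : N % suc i ≡ suc x
  N%≡ = sym (enc 0)
  Q : ℕ
  Q = N ∸ N % suc i
  N+i≡ : N + i ≡ (Q + suc i) + x
  N+i≡ = begin
    N + i                      ≡⟨ cong (_+ i) (m∸n+n≡m (m%n≤m N (suc i))) ⟨
    Q + N % suc i + i          ≡⟨ cong (λ r → Q + r + i) N%≡ ⟩
    Q + suc x + i              ≡⟨ shuffle Q x i ⟩
    Q + suc i + x              ∎
    where
    open ≡-Reasoning
    shuffle : ∀ Q x i → Q + suc x + i ≡ Q + suc i + x
    shuffle = solve-∀
  x<i+1 : x < suc i
  x<i+1 = <-trans (n<1+n x) (subst (_< suc i) N%≡ (m%n<n N (suc i)))
  split : (N + i) % suc i ≡ x × N + i ∸ (N + i) % suc i ≡ Q + suc i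
  split = digitSplit i (Q + suc i) x N+i≡ (∣m∣n⇒∣m+n (∣m∸m%n N (suc i)) ∣-refl) x<i+1
  ih : Encodes (suc i) (Q + suc i) (stepFrom (suc i) xs)
  ih = stepEncodes xs (suc i) Q (λ j → enc (suc j))

boardEncodes : ∀ n → Encodes 1 n (board n)
boardEncodes zero    = zeroDigits 1
  where
  zeroDigits : ∀ i j → 0 ≡ digit i 0 j
  zeroDigits i zero    = refl
  zeroDigits i (suc j) = zeroDigits (suc i) j
boardEncodes (suc n) =
  subst (λ N → Encodes 1 N (board (suc n))) (+-comm n 1) (stepEncodes (board n) 1 n (boardEncodes n))

-- restFrom i N j is what remains of N once the digits at positions
-- i, …, i+j-1 have been removed, computed from the back.
restFrom : ℕ → ℕ → ℕ → ℕ
restFrom i N zero    = N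
restFrom i N (suc j) = restFrom i N j ∸ restFrom i N j % (suc i + j)

restFrom-front : ∀ i N j → restFrom i N (suc j) ≡ restFrom (suc i) (N ∸ N % suc i) j
restFrom-front i N zero    rewrite +-identityʳ i = refl
restFrom-front i N (suc j) rewrite restFrom-front i N j | +-suc i j = refl

digit-restFrom : ∀ i N j → digit i N j ≡ restFrom i N j % (suc i + j)
digit-restFrom i N zero    rewrite +-identityʳ i = refl
digit-restFrom i N (suc j)
  rewrite digit-restFrom (suc i) (N ∸ N % suc i) j | restFrom-front i N j | +-suc i j = refl

-- rest n j = n - (b₁(n) + ⋯ + b_j(n)).
rest : ℕ → ℕ → ℕ
rest n = restFrom 1 n

bbar≡rest% : ∀ n j → bbar n (2 + j) ≡ rest n j % (2 + j)
bbar≡rest% n j = trans (boardEncodes n j) (digit-restFrom 1 n j)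

-- Matching a board prefix is a system of congruences

prefixSum : (ℕ → ℕ) → ℕ → ℕ
prefixSum m zero          = 0
prefixSum m (suc zero)    = 0
prefixSum m (suc (suc j)) = prefixSum m (suc j) + m (suc (suc j))

Matches : ℕ → (ℕ → ℕ) → ℕ → Set
Matches k m n = ∀ i → 2 ≤ i → i ≤ k → bbar n i ≡ m i

Congruent : ℕ → (ℕ → ℕ) → ℕ → Set
Congruent k m n = ∀ i → 2 ≤ i → i ≤ k → n ≡[ i ] prefixSum m i

-- Reading the board of n left to right against the target digits m:
-- each digit read is subtracted from rest and added to the prefix sum.
module Accounting (m : ℕ → ℕ) (n : ℕ) where

  -- While the digits read so far are m₂, …, m_{j+1}, nothing has been lost.
  Balanced : ℕ → Set
  Balanced j = rest n j + prefixSum m (suc j) ≡ n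

  balanced-step : ∀ j → Balanced j → rest n j % (2 + j) ≡ m (2 + j) → Balanced (suc j)
  balanced-step j bal digit≡ = begin
    (R ∸ r) + (prefixSum m (suc j) + m (2 + j))  ≡⟨ cong (λ x → (R ∸ r) + (prefixSum m (suc j) + x)) digit≡ ⟨
    (R ∸ r) + (prefixSum m (suc j) + r)          ≡⟨ regroup (R ∸ r) (prefixSum m (suc j)) r ⟩
    (R ∸ r) + r + prefixSum m (suc j)            ≡⟨ cong (_+ prefixSum m (suc j)) (m∸n+n≡m (m%n≤m R (2 + j))) ⟩
    R + prefixSum m (suc j)                      ≡⟨ bal ⟩
    n                                            ∎
    where
    open ≡-Reasoning
    R r : ℕ
    R = rest n j
    r = R % (2 + j)
    regroup : ∀ a s r → a + (s + r) ≡ a + r + s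
    regroup = solve-∀

  -- Balance at j+1 is the congruence modulo j+2, as (j+2) divides the rest.
  balanced⇒≡ : ∀ j → Balanced (suc j) → n ≡[ 2 + j ] prefixSum m (2 + j)
  balanced⇒≡ j bal = subst (_≡[ 2 + j ] prefixSum m (2 + j)) bal
    (subst (rest n (suc j) + prefixSum m (2 + j) ≡[ 2 + j ]_) (+-identityˡ _)
      (≡mod-+ (+-multiple 0 (∣m∸m%n (rest n j) (2 + j))) (≡mod-refl (prefixSum m (2 + j)))))

  ≡⇒digit : ∀ j → Balanced j → m (2 + j) < 2 + j → n ≡[ 2 + j ] prefixSum m (2 + j) →
            rest n j % (2 + j) ≡ m (2 + j)
  ≡⇒digit j bal m<j+2 n≡ = ≡mod⇒% (≡mod-cancelʳ (prefixSum m (suc j)) shifted) m<j+2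
    where
    shifted : rest n j + prefixSum m (suc j) ≡[ 2 + j ] m (2 + j) + prefixSum m (suc j)
    shifted = subst₂ (_≡[ 2 + j ]_) (sym bal) (+-comm (prefixSum m (suc j)) (m (2 + j))) n≡

  balanced : ∀ k → (∀ j → 2 + j ≤ k → Balanced j → rest n j % (2 + j) ≡ m (2 + j)) →
             ∀ j → suc j ≤ k → Balanced j
  balanced k digits zero    _     = +-identityʳ n
  balanced k digits (suc j) j+2≤k = balanced-step j bal (digits j j+2≤k bal)
    where
    bal : Balanced j
    bal = balanced k digits j (<⇒≤ j+2≤k)

module _ {k : ℕ} {m : ℕ → ℕ} where

  matches⇒congruent : ∀ n → Matches k m n → Congruent k m n
  matches⇒congruent n match (suc zero)    (s≤s ()) _
  matches⇒congruent n match (suc (suc j)) _        j+2≤k =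
    balanced⇒≡ j (balanced k digits (suc j) j+2≤k)
    where
    open Accounting m n
    digits : ∀ j → 2 + j ≤ k → Balanced j → rest n j % (2 + j) ≡ m (2 + j)
    digits j j+2≤k _ = trans (sym (bbar≡rest% n j)) (match (2 + j) (s≤s (s≤s z≤n)) j+2≤k)

  congruent⇒matches : (∀ i → 2 ≤ i → i ≤ k → m i < i) → ∀ n → Congruent k m n → Matches k m n
  congruent⇒matches m<i n n≡ (suc zero)    (s≤s ()) _
  congruent⇒matches m<i n n≡ (suc (suc j)) _        j+2≤k =
    trans (bbar≡rest% n j) (digits j j+2≤k (balanced k digits j (<⇒≤ j+2≤k)))
    where
    open Accounting m n
    digits : ∀ j → 2 + j ≤ k → Balanced j → rest n j % (2 + j) ≡ m (2 + j)
    digits j j+2≤k bal = ≡⇒digit j bal (m<i (2 + j) 2≤j+2 j+2≤k) (n≡ (2 + j) 2≤j+2 j+2≤k)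
      where
      2≤j+2 : 2 ≤ 2 + j
      2≤j+2 = s≤s (s≤s z≤n)

-- Windows: the conditions of the theorem compare prefix sums

prefixSum-window : ∀ m i d → d < i → prefixSum m i ≡ prefixSum m (i ∸ d) + windowSum m i d
prefixSum-window m i zero    _   = sym (+-identityʳ _)
prefixSum-window m i (suc d) d<i = begin
  prefixSum m i                                                     ≡⟨ prefixSum-window m i d (<⇒≤ d<i) ⟩
  prefixSum m (i ∸ d) + windowSum m i d                             ≡⟨ cong (λ j → prefixSum m j + windowSum m i d) i∸d≡ ⟩
  prefixSum m (suc (i ∸ suc d)) + windowSum m i d                   ≡⟨ cong (_+ windowSum m i d) (prefixSum-suc (m<n⇒0<n∸m d<i)) ⟩
  prefixSum m (i ∸ suc d) + m (suc (i ∸ suc d)) + windowSum m i d   ≡⟨ cong (λ j → prefixSum m (i ∸ suc d) + m j + windowSum m i d) i∸d≡ ⟨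
  prefixSum m (i ∸ suc d) + m (i ∸ d) + windowSum m i d             ≡⟨ +-assoc (prefixSum m (i ∸ suc d)) _ _ ⟩
  prefixSum m (i ∸ suc d) + windowSum m i (suc d)                   ∎
  where
  open ≡-Reasoning
  i∸d≡ : i ∸ d ≡ suc (i ∸ suc d)
  i∸d≡ = +-∸-assoc 1 (<⇒≤ d<i)
  prefixSum-suc : ∀ {j} → 1 ≤ j → prefixSum m (suc j) ≡ prefixSum m j + m (suc j)
  prefixSum-suc {suc j} _ = refl

module _ {m : ℕ → ℕ} {i d : ℕ} (d<i : d < i) where

  ∣window⇒≡ : d ∣ windowSum m i d → prefixSum m (i ∸ d) ≡[ d ] prefixSum m i
  ∣window⇒≡ d∣w = subst (prefixSum m (i ∸ d) ≡[ d ]_) (sym (prefixSum-window m i d d<i))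
    (≡mod-sym (+-multiple (prefixSum m (i ∸ d)) d∣w))

  ≡⇒∣window : prefixSum m (i ∸ d) ≡[ d ] prefixSum m i → d ∣ windowSum m i d
  ≡⇒∣window S≡ = ≡0⇒∣ (≡mod-cancelʳ (prefixSum m (i ∸ d)) (subst (_≡[ d ] prefixSum m (i ∸ d)) split (≡mod-sym S≡)))
    where
    split : prefixSum m i ≡ windowSum m i d + prefixSum m (i ∸ d)
    split = trans (prefixSum-window m i d d<i) (+-comm (prefixSum m (i ∸ d)) (windowSum m i d))

properDivisor : ∀ {d i} → d ∣ i → d < i → ∃[ a ] i ∸ d ≡ suc a * d
properDivisor     (divides zero          refl) d<0 = contradiction d<0 λ ()
properDivisor {d} (divides (suc zero) refl) d<d = contradiction (subst (d <_) (+-identityʳ d) d<d) (n≮n d)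
properDivisor {d} (divides (suc (suc a)) refl) _ = a , m+n∸m≡n d (suc a * d)

congruent-complement : ∀ {k m n i d} → Congruent k m n → d ∣ i → 1 < d → d < i → i ∸ d ≤ k →
                       n ≡[ d ] prefixSum m (i ∸ d)
congruent-complement {i = i} {d} n≡ d∣i 1<d d<i i∸d≤k with properDivisor d∣i d<i
... | a , i∸d≡ = ≡mod-∣ (divides (suc a) i∸d≡) (n≡ (i ∸ d) 2≤i∸d i∸d≤k)
  where
  2≤i∸d : 2 ≤ i ∸ d
  2≤i∸d = subst (2 ≤_) (sym i∸d≡) (≤-trans 1<d (m≤n*m d (suc a)))

congruent⇒window : ∀ {k m n} → Congruent k m n → ∀ i → 2 ≤ i → i ≤ k →
                   ∀ d → d ∣ i → 1 < d → d < i → d ∣ windowSum m i d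
congruent⇒window {m = m} {n} n≡ i 2≤i i≤k d d∣i 1<d d<i = ≡⇒∣window d<i (≡mod-trans
  (≡mod-sym (congruent-complement n≡ d∣i 1<d d<i (≤-trans (m∸n≤m i d) i≤k)))
  (≡mod-∣ d∣i (n≡ i 2≤i i≤k)))

-- Periodicity

∣lcmUpTo : ∀ k i → 1 ≤ i → i ≤ k → i ∣ lcmUpTo k
∣lcmUpTo zero    i 1≤i i≤0 = contradiction i≤0 (<⇒≱ 1≤i)
∣lcmUpTo (suc k) i 1≤i i≤k+1 with m≤n⇒m<n∨m≡n i≤k+1
... | inj₁ (s≤s i≤k) = ∣-trans (∣lcmUpTo k i 1≤i i≤k) (n∣lcm[m,n] (suc k) (lcmUpTo k))
... | inj₂ refl      = m∣lcm[m,n] (suc k) (lcmUpTo k)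

congruent-shift : ∀ {k m n n'} → Congruent k m n → n' ≡[ lcmUpTo k ] n → Congruent k m n'
congruent-shift {k} n≡ n'≡n i 2≤i i≤k = ≡mod-trans (≡mod-∣ (∣lcmUpTo k i (<⇒≤ 2≤i) i≤k) n'≡n) (n≡ i 2≤i i≤k)

ℤ-shift⇒≡ : ∀ L n n' (r : ℤ) → + n' ≡ + n ℤ.+ r ℤ.* + L → n' ≡[ L ] n
ℤ-shift⇒≡ L n n' (+ r) eq = subst (_≡[ L ] n) (sym n'≡) (+-multiple n (n∣m*n r))
  where
  n'≡ : n' ≡ n + r * L
  n'≡ = ℤP.+-injective (begin
    + n'                  ≡⟨ eq ⟩
    + n ℤ.+ + r ℤ.* + L   ≡⟨ cong (ℤ._+_ (+ n)) (ℤP.pos-* r L) ⟨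
    + n ℤ.+ + (r * L)     ≡⟨ ℤP.pos-+ n (r * L) ⟨
    + (n + r * L)         ∎)
    where open ≡-Reasoning
ℤ-shift⇒≡ L n n' -[1+ r ] eq = ≡mod-sym (subst (_≡[ L ] n') n≡ (+-multiple n' (n∣m*n (suc r))))
  where
  cancel : ∀ (x y z : ℤ) → (x ℤ.+ (ℤ.- y) ℤ.* z) ℤ.+ y ℤ.* z ≡ x
  cancel = ℤ-Solver.solve-∀
  n≡ : n' + suc r * L ≡ n
  n≡ = ℤP.+-injective (begin
    + (n' + suc r * L)                               ≡⟨ ℤP.pos-+ n' (suc r * L) ⟩
    + n' ℤ.+ + (suc r * L)                           ≡⟨ cong (ℤ._+_ (+ n')) (ℤP.pos-* (suc r) L) ⟩
    + n' ℤ.+ + suc r ℤ.* + L                         ≡⟨ cong (ℤ._+ + suc r ℤ.* + L) eq ⟩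
    (+ n ℤ.+ -[1+ r ] ℤ.* + L) ℤ.+ + suc r ℤ.* + L   ≡⟨ cancel (+ n) (+ suc r) (+ L) ⟩
    + n                                              ∎)
    where open ≡-Reasoning

-- Prime powers

PrimePower : ℕ → Set
PrimePower q = ∃[ p ] ∃[ e ] (Prime p × 1 ≤ e × q ≡ p ^ e)

prime>1 : ∀ {p} → Prime p → 1 < p
prime>1 {p} p-prime = nonTrivial⇒n>1 p {{prime⇒nonTrivial p-prime}}

primePower>1 : ∀ {q} → PrimePower q → 1 < q
primePower>1 (p , suc e , p-prime , _ , refl) = ^-monoʳ-< p (prime>1 p-prime) {0} {suc e} z<s

primeFactor : ∀ d → 2 ≤ d → ∃[ p ] (Prime p × p ∣ d)
primeFactor d 2≤d with factorise d {{>-nonZero (<-trans z<s 2≤d)}}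
... | record { factors = [] ; isFactorisation = d≡1 } = contradiction (sym d≡1) (<⇒≢ 2≤d)
... | record { factors = p ∷ ps ; isFactorisation = d≡ ; factorsPrime = p-prime ∷ _ } =
  p , p-prime , divides (product ps) (trans d≡ (*-comm p (product ps)))

^-∣ : ∀ p {v e} → v ≤ e → p ^ v ∣ p ^ e
^-∣ p {v} {e} v≤e = divides (p ^ (e ∸ v)) (begin
  p ^ e                ≡⟨ cong (p ^_) (m+[n∸m]≡n v≤e) ⟨
  p ^ (v + (e ∸ v))    ≡⟨ ^-distribˡ-+-* p v (e ∸ v) ⟩
  p ^ v * p ^ (e ∸ v)  ≡⟨ *-comm (p ^ v) _ ⟩
  p ^ (e ∸ v) * p ^ v  ∎)
  where open ≡-Reasoning

coprime-∣-* : ∀ {a b z} → Coprime a b → a ∣ z → b ∣ z → a * b ∣ z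
coprime-∣-* {a} {b} a⊥b a∣z (divides w refl) =
  *-monoˡ-∣ b (coprime-divisor a⊥b (subst (a ∣_) (*-comm w b) a∣z))

module _ {p : ℕ} (p-prime : Prime p) where

  instance
    p≢0 : NonZero p
    p≢0 = prime⇒nonZero p-prime

  pSplit : ∀ d → 0 < d → ∃[ v ] ∃[ u ] (d ≡ p ^ v * u × ¬ p ∣ u × 0 < u)
  pSplit = <-rec _ split
    where
    split : ∀ d → (∀ {d'} → d' < d → 0 < d' → ∃[ v ] ∃[ u ] (d' ≡ p ^ v * u × ¬ p ∣ u × 0 < u)) →
            0 < d → ∃[ v ] ∃[ u ] (d ≡ p ^ v * u × ¬ p ∣ u × 0 < u)
    split d rec 0<d with p ∣? d
    ... | no p∤d = 0 , d , sym (+-identityʳ d) , p∤d , 0<d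
    ... | yes (divides q refl) with rec q<d 0<q
      where
      0<q : 0 < q
      0<q = n≢0⇒n>0 λ { refl → <⇒≢ 0<d refl }
      q<d : q < q * p
      q<d = m<m*n q p {{>-nonZero 0<q}} (prime>1 p-prime)
    ... | v , u , refl , p∤u , 0<u = suc v , u , regroup (p ^ v) u p , p∤u , 0<u
      where
      regroup : ∀ a b c → a * b * c ≡ c * a * b
      regroup = solve-∀

  coprime-^ : ∀ {u} → ¬ p ∣ u → ∀ v → Coprime u (p ^ v)
  coprime-^ p∤u zero    (c∣u , c∣1)  = ∣1⇒≡1 c∣1
  coprime-^ {u} p∤u (suc v) {c} (c∣u , c∣p^v+1) = coprime-^ p∤u v (c∣u , coprime-divisor c⊥p c∣p^v+1)
    where
    c⊥p : Coprime c p
    c⊥p (e∣c , e∣p) with prime⇒irreducible p-prime e∣p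
    ... | inj₁ e≡1 = e≡1
    ... | inj₂ e≡p = contradiction (subst (_∣ u) e≡p (∣-trans e∣c c∣u)) p∤u

  -- lcm preserves being prime to p (Euclid's lemma, as lcm a b ∣ a·b).
  ∤-lcm : ∀ {a b} → ¬ p ∣ a → ¬ p ∣ b → ¬ p ∣ lcm a b
  ∤-lcm {a} {b} p∤a p∤b p∣lcm with euclidsLemma a b p-prime (∣-trans p∣lcm (lcm-least (m∣m*n {a} b) (n∣m*n a)))
  ... | inj₁ p∣a = p∤a p∣a
  ... | inj₂ p∣b = p∤b p∣b

  -- As long as K < p^(e+1), every number up to K has p-part at most p^e.
  lcmUpTo-pPart : ∀ e K → K < p ^ suc e → ∃[ M ] (lcmUpTo K ∣ p ^ e * M × ¬ p ∣ M)
  lcmUpTo-pPart e zero    _       = 1 , 1∣ _ , λ p∣1 → <⇒≢ (prime>1 p-prime) (sym (∣1⇒≡1 p∣1))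
  lcmUpTo-pPart e (suc K) K+1<p^e+1
    with lcmUpTo-pPart e K (<-trans (n<1+n K) K+1<p^e+1) | pSplit (suc K) z<s
  ... | M , lcm∣ , p∤M | v , u , K+1≡ , p∤u , 0<u =
    lcm M u , lcm-least K+1∣ (∣-trans lcm∣ (*-monoʳ-∣ (p ^ e) (m∣lcm[m,n] M u))) , ∤-lcm p∤M p∤u
    where
    v≤e : v ≤ e
    v≤e with v ≤? e
    ... | yes v≤e = v≤e
    ... | no v≰e  = contradiction K+1<p^e+1 (≤⇒≯ (begin
      p ^ suc e ≤⟨ ^-monoʳ-≤ p (≰⇒> v≰e) ⟩
      p ^ v     ≤⟨ m≤m*n (p ^ v) u {{>-nonZero 0<u}} ⟩
      p ^ v * u ≡⟨ K+1≡ ⟨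
      suc K     ∎))
      where open ≤-Reasoning
    K+1∣ : suc K ∣ p ^ e * lcm M u
    K+1∣ = subst (_∣ p ^ e * lcm M u) (sym K+1≡) (*-pres-∣ (^-∣ p v≤e) (n∣lcm[m,n] M u))

  ^∤lcmUpTo : ∀ e K → p ^ suc e ≡ suc K → ¬ p ^ suc e ∣ lcmUpTo K
  ^∤lcmUpTo e K p^e+1≡ p^e+1∣ with lcmUpTo-pPart e K (subst (K <_) (sym p^e+1≡) (n<1+n K))
  ... | M , lcm∣ , p∤M =
    p∤M (*-cancelˡ-∣ (p ^ e) {{m^n≢0 p e}}
      (subst (_∣ p ^ e * M) (*-comm p (p ^ e)) (∣-trans p^e+1∣ lcm∣)))

primePower∤lcmUpTo : ∀ {K} → PrimePower (suc K) → ¬ suc K ∣ lcmUpTo K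
primePower∤lcmUpTo {K} (p , suc e , p-prime , _ , K+1≡) = subst (λ q → ¬ q ∣ lcmUpTo K) (sym K+1≡)
  (^∤lcmUpTo p-prime e K (sym K+1≡))

primePowers⇒∣ : ∀ {z} d → 0 < d → (∀ q → PrimePower q → q ∣ d → q ∣ z) → d ∣ z
primePowers⇒∣ {z} = <-rec _ go
  where
  go : ∀ d → (∀ {d'} → d' < d → 0 < d' → (∀ q → PrimePower q → q ∣ d' → q ∣ z) → d' ∣ z) →
       0 < d → (∀ q → PrimePower q → q ∣ d → q ∣ z) → d ∣ z
  go (suc zero)      rec _   _     = 1∣ z
  go d@(suc (suc _)) rec 0<d local with primeFactor d (s≤s (s≤s z≤n))
  ... | p , p-prime , p∣d with pSplit p-prime d 0<d
  ...   | zero   , u , d≡ , p∤u , _   = contradiction (subst (p ∣_) (trans d≡ (*-identityˡ u)) p∣d) p∤u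
  ...   | suc v , u , d≡ , p∤u , 0<u =
    subst (_∣ z) (trans (*-comm u P) (sym d≡)) (coprime-∣-* (coprime-^ p-prime p∤u (suc v)) u∣z P∣z)
    where
    P : ℕ
    P = p ^ suc v
    P-pp : PrimePower P
    P-pp = p , suc v , p-prime , s≤s z≤n , refl
    u∣d : u ∣ d
    u∣d = divides P d≡
    u<d : u < d
    u<d = subst (u <_) (trans (*-comm u P) (sym d≡))
      (m<m*n u P {{>-nonZero 0<u}} (primePower>1 P-pp))
    u∣z : u ∣ z
    u∣z = rec u<d 0<u λ q q-pp q∣u → local q q-pp (∣-trans q∣u u∣d)
    P∣z : P ∣ z
    P∣z = local P P-pp (divides u (trans d≡ (*-comm P u)))

-- From divisibility to congruences

∣∸⇒≡ : ∀ {d x y} → y ≤ x → d ∣ x ∸ y → x ≡[ d ] y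
∣∸⇒≡ {d} {x} {y} y≤x d∣x∸y = subst (_≡[ d ] y) (m+[n∸m]≡n y≤x) (+-multiple y d∣x∸y)

≡⇒∣∸ : ∀ {d x y} → y ≤ x → x ≡[ d ] y → d ∣ x ∸ y
≡⇒∣∸ {d} {x} {y} y≤x x≡y = ≡0⇒∣ (≡mod-cancelʳ y (subst (_≡[ d ] y) (sym (m∸n+n≡m y≤x)) x≡y))

primePowers⇒≡-ordered : ∀ d {x y} → 0 < d → y ≤ x → (∀ q → PrimePower q → q ∣ d → x ≡[ q ] y) → x ≡[ d ] y
primePowers⇒≡-ordered d 0<d y≤x local =
  ∣∸⇒≡ y≤x (primePowers⇒∣ d 0<d λ q q-pp q∣d → ≡⇒∣∸ y≤x (local q q-pp q∣d))

primePowers⇒≡ : ∀ d {x y} → 0 < d → (∀ q → PrimePower q → q ∣ d → x ≡[ q ] y) → x ≡[ d ] y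
primePowers⇒≡ d {x} {y} 0<d local with ≤-total y x
... | inj₁ y≤x = primePowers⇒≡-ordered d 0<d y≤x local
... | inj₂ x≤y = ≡mod-sym (primePowers⇒≡-ordered d 0<d x≤y λ q q-pp q∣d → ≡mod-sym (local q q-pp q∣d))

bézout-mod : ∀ L K → ∃[ w ] w * L ≡[ suc K ] gcd L (suc K)
bézout-mod L K with Bézout.identity (gcd-GCD L (suc K))
... | Bézout.+- w y eq = w , 0 , y , trans (+-identityʳ _) (sym eq)
... | Bézout.-+ x y eq = K * x , y , x * L , (begin
  K * x * L + y * suc K       ≡⟨ cong (_+_ (K * x * L)) eq ⟨
  K * x * L + (g + x * L)     ≡⟨ regroup K x L g ⟩
  g + x * L * suc K           ∎)
  where
  open ≡-Reasoning
  g : ℕ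
  g = gcd L (suc K)
  regroup : ∀ K x L g → K * x * L + (g + x * L) ≡ g + x * L * suc K
  regroup = solve-∀

crt-step : ∀ L K {x y} → x ≡[ gcd L (suc K) ] y → ∃[ t ] x + t * L ≡[ suc K ] y
crt-step L K {x} {y} (a , b , x≡y) with bézout-mod L K
... | w , wL≡g = t , ≡mod-trans (≡mod-+ (≡mod-refl x) tL≡) (subst (_≡[ suc K ] y) (sym rearranged) (+-multiple y (n∣m*n (b * g))))
  where
  g : ℕ
  g = gcd L (suc K)
  c t : ℕ
  c = a + K * b
  t = c * w
  tL≡ : t * L ≡[ suc K ] c * g
  tL≡ = subst (_≡[ suc K ] c * g) (sym (*-assoc c w L)) (≡mod-*ˡ c wL≡g)
  regroup : ∀ x a K b g → x + (a + K * b) * g ≡ (x + a * g) + K * b * g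
  regroup = solve-∀
  collect : ∀ y b g K → (y + b * g) + K * b * g ≡ y + b * g * suc K
  collect = solve-∀
  rearranged : x + c * g ≡ y + b * g * suc K
  rearranged = trans (regroup x a K b g) (trans (cong (_+ K * b * g) x≡y) (collect y b g K))

-- Sufficiency: building a solution one modulus at a time

WindowConditions : ℕ → (ℕ → ℕ) → Set
WindowConditions k m = ∀ i → 2 ≤ i → i ≤ k → ∀ d → d ∣ i → 1 < d → d < i →
                       PrimePower d → d ∣ windowSum m i d

module Sufficiency {k : ℕ} {m : ℕ → ℕ} (windows : WindowConditions k m) where

  -- A solution n of the first K congruences already satisfies the
  -- (K+1)-st modulo gcd(lcm(1, …, K), K+1): a prime power q dividing
  -- this gcd is a proper divisor of K+1 (as K+1 ∤ lcm(1, …, K) when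
  -- K+1 is a prime power), so the window condition for q at K+1 applies.
  compatible : ∀ {K n} → suc K ≤ k → Congruent K m n →
               n ≡[ gcd (lcmUpTo K) (suc K) ] prefixSum m (suc K)
  compatible {K} {n} K+1≤k n≡ = primePowers⇒≡ _ 0<gcd local
    where
    0<gcd : 0 < gcd (lcmUpTo K) (suc K)
    0<gcd = n≢0⇒n>0 (gcd[m,n]≢0 (lcmUpTo K) (suc K) (inj₂ λ ()))
    local : ∀ q → PrimePower q → q ∣ gcd (lcmUpTo K) (suc K) → n ≡[ q ] prefixSum m (suc K)
    local q q-pp q∣g = ≡mod-trans
      (congruent-complement n≡ q∣K+1 1<q q<K+1 (∸-monoʳ-≤ (suc K) (<⇒≤ 1<q)))
      (∣window⇒≡ q<K+1 (windows (suc K) (≤-trans 1<q (<⇒≤ q<K+1)) K+1≤k q q∣K+1 1<q q<K+1 q-pp))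
      where
      q∣K+1 : q ∣ suc K
      q∣K+1 = ∣-trans q∣g (gcd[m,n]∣n (lcmUpTo K) (suc K))
      1<q : 1 < q
      1<q = primePower>1 q-pp
      q<K+1 : q < suc K
      q<K+1 with m≤n⇒m<n∨m≡n (∣⇒≤ q∣K+1)
      ... | inj₁ q<K+1 = q<K+1
      ... | inj₂ refl  = contradiction (∣-trans q∣g (gcd[m,n]∣m (lcmUpTo K) (suc K))) (primePower∤lcmUpTo q-pp)

  extend : ∀ {K n} → suc K ≤ k → Congruent K m n → ∃[ n' ] Congruent (suc K) m n'
  extend {K} {n} K+1≤k n≡ = shiftBy (crt-step (lcmUpTo K) K (compatible K+1≤k n≡))
    where
    shiftBy : ∃[ t ] n + t * lcmUpTo K ≡[ suc K ] prefixSum m (suc K) → ∃[ n' ] Congruent (suc K) m n'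
    shiftBy (t , shifted≡) = n + t * lcmUpTo K , solves
      where
      solves : Congruent (suc K) m (n + t * lcmUpTo K)
      solves i 2≤i i≤K+1 with m≤n⇒m<n∨m≡n i≤K+1
      ... | inj₁ (s≤s i≤K) = congruent-shift n≡ (+-multiple n (n∣m*n t)) i 2≤i i≤K
      ... | inj₂ refl      = shifted≡

  solution : ∀ K → K ≤ k → ∃[ n ] Congruent K m n
  solution zero    _     = 0 , λ i 2≤i i≤0 → contradiction (≤-trans 2≤i i≤0) λ ()
  solution (suc K) K+1≤k with solution K (<⇒≤ K+1≤k)
  ... | n , n≡ = extend K+1≤k n≡

theorem4p5 : (k : ℕ) → 2 ≤ k → (m : ℕ → ℕ) → (∀ i → 2 ≤ i → i ≤ k → m i < i) →
    ((∃[ n ] (∀ i → 2 ≤ i → i ≤ k → bbar n i ≡ m i))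
      ⇔ (∀ i → 2 ≤ i → i ≤ k → ∀ d → d ∣ i → 1 < d → d < i →
           (∃[ q ] ∃[ e ] (Prime q × 1 ≤ e × d ≡ q ^ e)) →
           d ∣ windowSum m i d))
    × (∀ n → (∀ i → 2 ≤ i → i ≤ k → bbar n i ≡ m i) →
         ∀ (r : ℤ) (n' : ℕ) → + n' ≡ + n ℤ.+ r ℤ.* + lcmUpTo k →
         ∀ i → 2 ≤ i → i ≤ k → bbar n' i ≡ m i)
theorem4p5 k _ m m<i = mk⇔ necessary sufficient , periodic
  where
  necessary : ∃[ n ] Matches k m n → WindowConditions k m
  necessary (n , match) i 2≤i i≤k d d∣i 1<d d<i _ =
    congruent⇒window (matches⇒congruent n match) i 2≤i i≤k d d∣i 1<d d<i

  sufficient : WindowConditions k m → ∃[ n ] Matches k m n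
  sufficient windows = matching (Sufficiency.solution windows k ≤-refl)
    where
    matching : ∃[ n ] Congruent k m n → ∃[ n ] Matches k m n
    matching (n , n≡) = n , congruent⇒matches m<i n n≡

  periodic : ∀ n → Matches k m n → ∀ (r : ℤ) (n' : ℕ) → + n' ≡ + n ℤ.+ r ℤ.* + lcmUpTo k →
             Matches k m n'
  periodic n match r n' n'≡ =
    congruent⇒matches m<i n' (congruent-shift (matches⇒congruent n match) (ℤ-shift⇒≡ (lcmUpTo k) n n' r n'≡))
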